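{- Let $a\neq 0$ and $b$ be complex constants and let $P(x),Q(x)$ be arbitrary formal Laurent series in $x$. Then $f\perp g$ for each of the following pairs $(f,g)$ of formal bilateral series: $$(f,g)=\big(P(x)+yQ(x),\;x-y\big),\quad \Big((1-axy)\big(1-b\tfrac{x}{y}\big),\;(x-y)\big(1-\tfrac{b}{axy}\big)\Big),\quad \Big((x+y)\big(x+\tfrac{b}{ay}\big),\;(x-y)\big(1-\tfrac{b}{axy}\big)\Big).$$
   Context: A formal bilateral series in $x,y$ is an expression $\sum_{i,j\in\mathbb{Z}}\lambda(i,j)x^iy^j$ with complex coefficients. For two such series $f,g$, $f\perp g$ means $$g(a',b')f(x',c')-g(a',c')f(x',b')+g(b',c')f(x',a')=0$$ identically in four independent variables $a',b',c',x'$. -}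

module Defs where

open import Level using (_⊔_)
open import Algebra.Bundles using (CommutativeRing)
open import Data.Integer using (ℤ; +_; -[1+_]) renaming (_<_ to _<ℤ_)
open import Data.Integer.Properties using () renaming (_≟_ to _≟ℤ_)
open import Data.Product using (∃; _×_)
open import Relation.Nullary using (yes; no)

-- Everything is done over an arbitrary commutative ring R of coefficients
-- (the paper uses ℂ, which is not available in agda-stdlib).
module Series {c ℓ} (R : CommutativeRing c ℓ) where
  open CommutativeRing R

  -- A formal bilateral series Σ_{i,j ∈ ℤ} λ(i,j) xⁱ yʲ, given by its
  -- coefficient function λ.
  BSeries : Set c
  BSeries = ℤ → ℤ → Carrier

  Series1 : Set c
  Series1 = ℤ → Carrier

  IsLaurent : Series1 → Set ℓ
  IsLaurent P = ∃ λ N → ∀ i → i <ℤ N → P i ≈ 0#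

  _⊕_ : BSeries → BSeries → BSeries
  (f ⊕ g) i j = f i j + g i j
  infixl 6 _⊕_

  mon : Carrier → ℤ → ℤ → BSeries
  mon k p q i j with i ≟ℤ p | j ≟ℤ q
  ... | yes _ | yes _ = k
  ... | _     | _     = 0#

  -- P(x) + y Q(x).
  liftPQ : Series1 → Series1 → BSeries
  liftPQ P Q i j with j ≟ℤ + 0 | j ≟ℤ + 1
  ... | yes _ | _     = P i
  ... | no _  | yes _ = Q i
  ... | no _  | no _  = 0#

  -- f ⊥ g :  g(a',b') f(x',c') - g(a',c') f(x',b') + g(b',c') f(x',a') = 0
  -- identically in a',b',c',x'.  Since each product is a product of series
  -- in disjoint variables, the coefficient of a'^i b'^j c'^k x'^l in the
  -- left-hand side is  g(i,j) f(l,k) - g(i,k) f(l,j) + g(j,k) f(l,i).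
  _⊥_ : BSeries → BSeries → Set ℓ
  f ⊥ g = ∀ (i j k l : ℤ) →
    g i j * f l k - g i k * f l j + g j k * f l i ≈ 0#

  -- Concrete series (products expanded by hand), with a⁻ = a⁻¹ and
  -- c = b a⁻¹ = b/a.

  xMinusY : BSeries
  xMinusY = mon 1# (+ 1) (+ 0) ⊕ mon (- 1#) (+ 0) (+ 1)

  -- (1 - a x y)(1 - b x/y) = 1 - b x y⁻¹ - a x y + a b x²
  f₂ : Carrier → Carrier → BSeries
  f₂ a b = mon 1# (+ 0) (+ 0) ⊕ mon (- b) (+ 1) -[1+ 0 ]
         ⊕ mon (- a) (+ 1) (+ 1) ⊕ mon (a * b) (+ 2) (+ 0)

  -- (x - y)(1 - b/(a x y)) = x - y - (b/a) y⁻¹ + (b/a) x⁻¹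
  g₂ : Carrier → Carrier → Carrier → BSeries
  g₂ a a⁻ b = mon 1# (+ 1) (+ 0) ⊕ mon (- 1#) (+ 0) (+ 1)
            ⊕ mon (- (b * a⁻)) (+ 0) -[1+ 0 ] ⊕ mon (b * a⁻) -[1+ 0 ] (+ 0)

  -- (x + y)(x + b/(a y)) = x² + (b/a) x y⁻¹ + x y + b/a
  f₃ : Carrier → Carrier → Carrier → BSeries
  f₃ a a⁻ b = mon 1# (+ 2) (+ 0) ⊕ mon (b * a⁻) (+ 1) -[1+ 0 ]
            ⊕ mon 1# (+ 1) (+ 1) ⊕ mon (b * a⁻) (+ 0) (+ 0)

{-# OPTIONS --safe #-}
-- Each g is of the form φ(x) − φ(y), with φ = x or φ = x + c/x for c = b/a,
-- and each f is affine in φ(y): f = α(x) + β(x) φ(y).  Coefficientwise, the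
-- ⊥-expression is then, up to sign, the determinant with rows (1, 1, 1),
-- (φ(a′), φ(b′), φ(c′)) and (f(x′,a′), f(x′,b′), f(x′,c′)), which vanishes
-- because the last row is a combination of the first two.
module Submission where

open import Defs
open import Algebra.Bundles using (CommutativeRing)
open import Data.Product using (_×_; _,_)
open import Data.Integer using (ℤ; +_; -[1+_])
open import Data.Integer.Properties using () renaming (_≟_ to _≟ℤ_)
open import Relation.Nullary using (yes; no)
import Relation.Binary.PropositionalEquality as ≡
import Algebra.Properties.AbelianGroup as AbelianGroupProperties
import Algebra.Properties.CommutativeSemigroup as CommutativeSemigroupProperties
import Algebra.Properties.Ring as RingProperties
import Algebra.Solver.Ring.NaturalCoefficients.Default as SemiringSolver

module _ {r ℓ} (R : CommutativeRing r ℓ) where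
  open CommutativeRing R
  open Series R
  open RingProperties ring using (-‿distribˡ-*; [y-z]x≈yx-zx)
  open AbelianGroupProperties +-abelianGroup
    using (⁻¹-∙-comm; ⁻¹-anti-homo‿-; x≈y⇒x∙y⁻¹≈ε)
  open CommutativeSemigroupProperties *-commutativeSemigroup using (x∙yz≈y∙xz)
  open SemiringSolver commutativeSemiring using (solve; _:=_; _:+_; _:*_; con)
  open import Relation.Binary.Reasoning.Setoid setoid

  a-b-c+d≈[a+d]-[b+c] : ∀ a b c d → a - b - c + d ≈ (a + d) - (b + c)
  a-b-c+d≈[a+d]-[b+c] a b c d = begin
      a + - b + - c + d
    ≈⟨ solve 4 (λ a b′ c′ d → a :+ b′ :+ c′ :+ d := a :+ d :+ (b′ :+ c′))
         refl a (- b) (- c) d ⟩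
      (a + d) + (- b + - c)
    ≈⟨ +-congˡ (⁻¹-∙-comm b c) ⟩
      (a + d) - (b + c)
    ∎

  [a-b]-[c-d]+[e-f]≈[a+d+e]-[b+c+f] : ∀ a b c d e f →
    (a - b) - (c - d) + (e - f) ≈ (a + d + e) - (b + c + f)
  [a-b]-[c-d]+[e-f]≈[a+d+e]-[b+c+f] a b c d e f = begin
      (a - b) - (c - d) + (e - f)
    ≈⟨ +-congʳ (+-congˡ (⁻¹-anti-homo‿- c d)) ⟩
      (a + - b) + (d + - c) + (e + - f)
    ≈⟨ solve 6 (λ a b′ c′ d e f′ →
         a :+ b′ :+ (d :+ c′) :+ (e :+ f′) := a :+ d :+ e :+ (b′ :+ c′ :+ f′))
         refl a (- b) (- c) d e (- f) ⟩
      (a + d + e) + (- b + - c + - f)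
    ≈⟨ +-congˡ (trans (+-congʳ (⁻¹-∙-comm b c)) (⁻¹-∙-comm (b + c) f)) ⟩
      (a + d + e) - (b + c + f)
    ∎

  x[yx⁻]≈y : ∀ {x x⁻} → x * x⁻ ≈ 1# → ∀ y → x * (y * x⁻) ≈ y
  x[yx⁻]≈y {x} {x⁻} xx⁻≈1 y = begin
    x * (y * x⁻)  ≈⟨ x∙yz≈y∙xz x y x⁻ ⟩
    y * (x * x⁻)  ≈⟨ *-congˡ xx⁻≈1 ⟩
    y * 1#        ≈⟨ *-identityʳ y ⟩
    y             ∎

  xpow : ℤ → Series1
  xpow p i with i ≟ℤ p
  ... | yes _ = 1#
  ... | no _  = 0#

  x⁰ x¹ x² x⁻¹ : Series1
  x⁰ = xpow (+ 0)
  x¹ = xpow (+ 1)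
  x² = xpow (+ 2)
  x⁻¹ = xpow -[1+ 0 ]

  mon-xpow : ∀ k p q i j → mon k p q i j ≈ k * (xpow p i * xpow q j)
  mon-xpow k p q i j with i ≟ℤ p | j ≟ℤ q
  ... | yes _ | yes _ = sym (trans (*-congˡ (*-identityˡ 1#)) (*-identityʳ k))
  ... | yes _ | no _  = sym (trans (*-congˡ (zeroʳ 1#)) (zeroʳ k))
  ... | no _  | _     = sym (trans (*-congˡ (zeroˡ _)) (zeroʳ k))

  mon-neg-xpow : ∀ k p q i j → mon (- k) p q i j ≈ - (k * (xpow p i * xpow q j))
  mon-neg-xpow k p q i j = trans (mon-xpow (- k) p q i j) (sym (-‿distribˡ-* k _))

  _≐_ : BSeries → BSeries → Set ℓ
  f ≐ g = ∀ i j → f i j ≈ g i j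

  ⊥-resp-≐ : ∀ {f f′ g g′} → f ≐ f′ → g ≐ g′ → f′ ⊥ g′ → f ⊥ g
  ⊥-resp-≐ f≐f′ g≐g′ f′⊥g′ i j k l =
    trans (+-cong (+-cong (*-cong (g≐g′ i j) (f≐f′ l k))
                          (-‿cong (*-cong (g≐g′ i k) (f≐f′ l j))))
                  (*-cong (g≐g′ j k) (f≐f′ l i)))
          (f′⊥g′ i j k l)

  difference : Series1 → BSeries
  difference φ i j = φ i * x⁰ j - x⁰ i * φ j

  affineIn : Series1 → Series1 → Series1 → BSeries
  affineIn φ α β l k = α l * x⁰ k + β l * φ k

  affineIn⊥difference : ∀ φ α β → affineIn φ α β ⊥ difference φ
  affineIn⊥difference φ α β i j k l = begin
      w i j * F k - w i k * F j + w j k * F i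
    ≈⟨ +-cong (+-cong ([y-z]x≈yx-zx (F k) _ _) (-‿cong ([y-z]x≈yx-zx (F j) _ _)))
              ([y-z]x≈yx-zx (F i) _ _) ⟩
      (φ i * x⁰ j) * F k - (x⁰ i * φ j) * F k
        - ((φ i * x⁰ k) * F j - (x⁰ i * φ k) * F j)
        + ((φ j * x⁰ k) * F i - (x⁰ j * φ k) * F i)
    ≈⟨ [a-b]-[c-d]+[e-f]≈[a+d+e]-[b+c+f] _ _ _ _ _ _ ⟩
      ((φ i * x⁰ j) * F k + (x⁰ i * φ k) * F j + (φ j * x⁰ k) * F i)
        - ((x⁰ i * φ j) * F k + (φ i * x⁰ k) * F j + (x⁰ j * φ k) * F i)
    ≈⟨ x≈y⇒x∙y⁻¹≈ε (solve 8 (λ oi oj ok φi φj φk a b →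
         let G = λ o φ → a :* o :+ b :* φ in
         (φi :* oj) :* G ok φk :+ (oi :* φk) :* G oj φj :+ (φj :* ok) :* G oi φi
           := (oi :* φj) :* G ok φk :+ (φi :* ok) :* G oj φj :+ (oj :* φk) :* G oi φi)
         refl (x⁰ i) (x⁰ j) (x⁰ k) (φ i) (φ j) (φ k) (α l) (β l)) ⟩
      0#
    ∎
    where
    w : BSeries
    w = difference φ
    F : Series1
    F = affineIn φ α β l

  xPlusCOverX : Carrier → Series1
  xPlusCOverX c i = x¹ i + c * x⁻¹ i

  xMinusY≐difference : xMinusY ≐ difference x¹
  xMinusY≐difference i j =
    +-cong (trans (mon-xpow _ _ _ i j) (*-identityˡ _))
           (trans (mon-neg-xpow _ _ _ i j) (-‿cong (*-identityˡ _)))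

  liftPQ≐affineIn : ∀ P Q → liftPQ P Q ≐ affineIn x¹ P Q
  liftPQ≐affineIn P Q l k with k ≟ℤ + 0 | k ≟ℤ + 1
  ... | yes _ | no _  = sym (trans (+-cong (*-identityʳ _) (zeroʳ _)) (+-identityʳ _))
  ... | no _  | yes _ = sym (trans (+-cong (zeroʳ _) (*-identityʳ _)) (+-identityˡ _))
  ... | no _  | no _  = sym (trans (+-cong (zeroʳ _) (zeroʳ _)) (+-identityʳ _))
  ... | yes ≡.refl | yes ()

  g₂≐difference : ∀ a a⁻ b → g₂ a a⁻ b ≐ difference (xPlusCOverX (b * a⁻))
  g₂≐difference a a⁻ b i j = begin
      g₂ a a⁻ b i j
    ≈⟨ +-cong (+-cong (+-cong (mon-xpow _ _ _ i j) (mon-neg-xpow _ _ _ i j))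
                      (mon-neg-xpow _ _ _ i j))
              (mon-xpow _ _ _ i j) ⟩
      1# * (x¹ i * x⁰ j) - 1# * (x⁰ i * x¹ j) - c * (x⁰ i * x⁻¹ j) + c * (x⁻¹ i * x⁰ j)
    ≈⟨ a-b-c+d≈[a+d]-[b+c] _ _ _ _ ⟩
      (1# * (x¹ i * x⁰ j) + c * (x⁻¹ i * x⁰ j))
        - (1# * (x⁰ i * x¹ j) + c * (x⁰ i * x⁻¹ j))
    ≈⟨ +-cong (solve 4 (λ c x m o →
                 con 1 :* (x :* o) :+ c :* (m :* o) := (x :+ c :* m) :* o)
                 refl c (x¹ i) (x⁻¹ i) (x⁰ j))
              (-‿cong (solve 4 (λ c x m o →
                 con 1 :* (o :* x) :+ c :* (o :* m) := o :* (x :+ c :* m))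
                 refl c (x¹ j) (x⁻¹ j) (x⁰ i))) ⟩
      difference (xPlusCOverX c) i j
    ∎
    where
    c : Carrier
    c = b * a⁻

  f₂≐affineIn : ∀ a b c → a * c ≈ b →
    f₂ a b ≐ affineIn (xPlusCOverX c) (λ l → x⁰ l + a * b * x² l) (λ l → - (a * x¹ l))
  f₂≐affineIn a b c ac≈b l k = begin
      f₂ a b l k
    ≈⟨ +-cong (+-cong (+-cong (mon-xpow _ _ _ l k) (mon-neg-xpow _ _ _ l k))
                      (mon-neg-xpow _ _ _ l k))
              (mon-xpow _ _ _ l k) ⟩
      1# * (x⁰ l * x⁰ k) - b * (x¹ l * x⁻¹ k) - a * (x¹ l * x¹ k) + a * b * (x² l * x⁰ k)
    ≈⟨ a-b-c+d≈[a+d]-[b+c] _ _ _ _ ⟩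
      (1# * (x⁰ l * x⁰ k) + a * b * (x² l * x⁰ k))
        - (b * (x¹ l * x⁻¹ k) + a * (x¹ l * x¹ k))
    ≈⟨ +-cong (solve 4 (λ ab o t o′ →
                 con 1 :* (o :* o′) :+ ab :* (t :* o′) := (o :+ ab :* t) :* o′)
                 refl (a * b) (x⁰ l) (x² l) (x⁰ k))
              (-‿cong (begin
                b * (x¹ l * x⁻¹ k) + a * (x¹ l * x¹ k)
                  ≈⟨ +-congʳ (*-congʳ (sym ac≈b)) ⟩
                a * c * (x¹ l * x⁻¹ k) + a * (x¹ l * x¹ k)
                  ≈⟨ solve 5 (λ a c x m x′ →
                       a :* c :* (x :* m) :+ a :* (x :* x′) := a :* x :* (x′ :+ c :* m))
                       refl a c (x¹ l) (x⁻¹ k) (x¹ k) ⟩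
                a * x¹ l * xPlusCOverX c k
                ∎)) ⟩
      (x⁰ l + a * b * x² l) * x⁰ k - a * x¹ l * xPlusCOverX c k
    ≈⟨ +-congˡ (-‿distribˡ-* _ _) ⟩
      affineIn (xPlusCOverX c) (λ l → x⁰ l + a * b * x² l) (λ l → - (a * x¹ l)) l k
    ∎

  f₃≐affineIn : ∀ a a⁻ b →
    f₃ a a⁻ b ≐ affineIn (xPlusCOverX (b * a⁻)) (λ l → x² l + b * a⁻ * x⁰ l) x¹
  f₃≐affineIn a a⁻ b l k = begin
      f₃ a a⁻ b l k
    ≈⟨ +-cong (+-cong (+-cong (mon-xpow _ _ _ l k) (mon-xpow _ _ _ l k))
                      (mon-xpow _ _ _ l k))
              (mon-xpow _ _ _ l k) ⟩
      1# * (x² l * x⁰ k) + c * (x¹ l * x⁻¹ k) + 1# * (x¹ l * x¹ k) + c * (x⁰ l * x⁰ k)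
    ≈⟨ solve 7 (λ c t o x m o′ x′ →
         con 1 :* (t :* o′) :+ c :* (x :* m) :+ con 1 :* (x :* x′) :+ c :* (o :* o′)
           := (t :+ c :* o) :* o′ :+ x :* (x′ :+ c :* m))
         refl c (x² l) (x⁰ l) (x¹ l) (x⁻¹ k) (x⁰ k) (x¹ k) ⟩
      affineIn (xPlusCOverX c) (λ l → x² l + c * x⁰ l) x¹ l k
    ∎
    where
    c : Carrier
    c = b * a⁻

corollary2p3 : ∀ {c ℓ} (R : CommutativeRing c ℓ) →
    let open CommutativeRing R
        open Series R
    in ∀ (a a⁻ b : Carrier) → a * a⁻ ≈ 1# →
       ∀ (P Q : Series1) → IsLaurent P → IsLaurent Q →
       (liftPQ P Q ⊥ xMinusY)
       × (f₂ a b ⊥ g₂ a a⁻ b)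
       × (f₃ a a⁻ b ⊥ g₂ a a⁻ b)
corollary2p3 R a a⁻ b aa⁻≈1 P Q _ _ =
    ⊥-resp-≐ R (liftPQ≐affineIn R P Q) (xMinusY≐difference R)
               (affineIn⊥difference R _ P Q)
  , ⊥-resp-≐ R (f₂≐affineIn R a b _ (x[yx⁻]≈y R aa⁻≈1 b)) (g₂≐difference R a a⁻ b)
               (affineIn⊥difference R _ _ _)
  , ⊥-resp-≐ R (f₃≐affineIn R a a⁻ b) (g₂≐difference R a a⁻ b)
               (affineIn⊥difference R _ _ _)
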